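{- Let $\mathcal I=(I_1,\dots,I_n)$ be a Grassmannlike necklace that is a weakly separated collection and whose trip permutation $\pi$ has no fixed points. Then every noncrossing toggle of $\mathcal I$ is an aligned toggle.
   Context: Indices mod $n$. A Grassmannlike necklace is an $n$-tuple $(I_1,\dots,I_n)$ of $k$-subsets of $[n]$ with permutations $\rho$ (removal) and $\iota$ (insertion) such that $\rho(a)\in I_a$ and $I_{a+1}=(I_a\setminus\{\rho(a)\})\cup\{\iota(a)\}$ for all $a$; its trip permutation is $\pi=\iota\rho^{ -1}$. Toggling at $a$ (allowed when $\rho(a-1)\ne\iota(a)$ and $\rho(a)\neq\iota(a-1)$) replaces $(\rho,\iota)$ by $(\rho s_{a-1},\iota s_{a-1})$ with $s_{a-1}$ the transposition of $a-1,a$. Chords $w\mapsto x$, $y\mapsto z$ in a disk with boundary points $1,\dots,n$ are noncrossing if they do not intersect (including at the boundary), and aligned if noncrossing and $w<_wy<_wz<_wx$ or $w<_wx<_wz<_wy$ (or, when $w=x$, $w<_wy<_wz$), where $<_w$ is $w<_ww+1<_w\dots<_ww-1$. The toggle at $a$ is noncrossing/aligned if the chords $\rho(a-1)\mapsto\iota(a-1)$ and $\rho(a)\mapsto\iota(a)$ are. $k$-subsets $I,J$ are weakly separated if there are no cyclically ordered $a<b<c<d$ with $a,c\in I\setminus J$ and $b,d\in J\setminus I$; a collection is weakly separated if pairwise so. -}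

module Defs where

open import Data.Nat as ℕ using (ℕ; zero; suc; _∸_; _≤ᵇ_)
open import Data.Bool using (if_then_else_)
open import Data.Fin using (Fin; toℕ; fromℕ<) renaming (zero to fzero)
open import Data.Nat.Properties using (≤-refl)
open import Data.Fin.Subset using (Subset; _∈_; _∉_; ⁅_⁆; _∪_; _-_; ∣_∣)
open import Data.Fin.Permutation using (Permutation′; _⟨$⟩ʳ_; _⟨$⟩ˡ_)
open import Data.Product using (Σ; _×_; ∃-syntax)
open import Data.Sum using (_⊎_)
open import Relation.Nullary using (¬_; yes; no)
open import Relation.Binary.PropositionalEquality using (_≡_; _≢_)

-- Cyclic structure on [n] = Fin n (the element i : Fin n stands for i+1).

cdist : ∀ {n} → Fin n → Fin n → ℕ
cdist {n} w y =
  if toℕ w ≤ᵇ toℕ y then toℕ y ∸ toℕ w else (n ℕ.+ toℕ y) ∸ toℕ w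

_<[_]_ : ∀ {n} → Fin n → Fin n → Fin n → Set
y <[ w ] z = cdist w y ℕ.< cdist w z

next : ∀ {n} → Fin n → Fin n
next {suc m} i with suc (toℕ i) ℕ.<? suc m
... | yes p = fromℕ< p
... | no _  = fzero

prev : ∀ {n} → Fin n → Fin n
prev {suc m} fzero = fromℕ< {m} {suc m} (ℕ.s≤s ≤-refl)
prev {suc m} (Data.Fin.suc i) = Data.Fin.inject₁ i

record GrassmannlikeNecklace (k n : ℕ) : Set where
  field
    I     : Fin n → Subset n
    ρ     : Permutation′ n
    ι     : Permutation′ n
    card  : ∀ a → ∣ I a ∣ ≡ k
    ρ∈I   : ∀ a → (ρ ⟨$⟩ʳ a) ∈ I a
    step  : ∀ a → I (next a) ≡ (I a - (ρ ⟨$⟩ʳ a)) ∪ ⁅ ι ⟨$⟩ʳ a ⁆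

  trip : Fin n → Fin n
  trip x = ι ⟨$⟩ʳ (ρ ⟨$⟩ˡ x)

open GrassmannlikeNecklace public

-- Chords  w ↦ x  and  y ↦ z

-- they do not intersect, including at the boundary
Noncrossing : ∀ {n} → (w x y z : Fin n) → Set
Noncrossing w x y z =
  w ≢ y × w ≢ z × x ≢ y × x ≢ z ×
  ¬ (w <[ w ] y × y <[ w ] x × x <[ w ] z) ×
  ¬ (w <[ w ] z × z <[ w ] x × x <[ w ] y)

Aligned : ∀ {n} → (w x y z : Fin n) → Set
Aligned w x y z =
  Noncrossing w x y z ×
  ( (w <[ w ] y × y <[ w ] z × z <[ w ] x)
  ⊎ (w <[ w ] x × x <[ w ] z × z <[ w ] y)
  ⊎ (w ≡ x × w <[ w ] y × y <[ w ] z))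

module _ {k n : ℕ} (𝓘 : GrassmannlikeNecklace k n) where
  private
    r : Fin n → Fin n
    r a = ρ 𝓘 ⟨$⟩ʳ a
    i : Fin n → Fin n
    i a = ι 𝓘 ⟨$⟩ʳ a

  ToggleAllowed : Fin n → Set
  ToggleAllowed a = r (prev a) ≢ i a × r a ≢ i (prev a)

  NoncrossingToggle : Fin n → Set
  NoncrossingToggle a =
    ToggleAllowed a × Noncrossing (r (prev a)) (i (prev a)) (r a) (i a)

  AlignedToggle : Fin n → Set
  AlignedToggle a =
    ToggleAllowed a × Aligned (r (prev a)) (i (prev a)) (r a) (i a)

WeaklySeparated : ∀ {n} → Subset n → Subset n → Set
WeaklySeparated {n} I J =
  ¬ (Σ (Fin n) λ a → Σ (Fin n) λ b → Σ (Fin n) λ c → Σ (Fin n) λ d →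
       (a <[ a ] b × b <[ a ] c × c <[ a ] d) ×
       (a ∈ I × a ∉ J) × (c ∈ I × c ∉ J) ×
       (b ∈ J × b ∉ I) × (d ∈ J × d ∉ I))

WeaklySeparatedNecklace : ∀ {k n} → GrassmannlikeNecklace k n → Set
WeaklySeparatedNecklace {n = n} 𝓘 = ∀ (a b : Fin n) → WeaklySeparated (I 𝓘 a) (I 𝓘 b)

-- With w ↦ x and y ↦ z the chords removed/inserted at a-1 and a, the trip permutation
-- sends w to x and y to z, so having no fixed points makes w, x, y, z pairwise distinct
-- (the noncrossing hypothesis supplies the other four inequalities). Passing from I_{a-1}
-- to I_{a+1} removes w and y and inserts x and z. Of the six cyclic orders of y, z, x
-- read from w, two are aligned, two make the chords cross, and in the remaining two the
-- points alternate between {w, y} ⊆ I_{a-1} ∖ I_{a+1} and {x, z} ⊆ I_{a+1} ∖ I_{a-1},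
-- contradicting weak separation of I_{a-1} and I_{a+1}.
module Submission where

open import Defs
open import Data.Nat using (ℕ)
open import Data.Fin using (Fin)
open import Relation.Binary.PropositionalEquality using (_≢_)

open import Level using (Level)
open import Data.Nat as ℕ using (suc; _∸_; _≤ᵇ_; _+_; s≤s)
import Data.Nat.Properties as ℕ
open import Data.Bool using (true; false; T)
open import Data.Unit using (tt)
open import Data.Empty using (⊥; ⊥-elim)
open import Data.Fin as Fin using (toℕ; inject₁) renaming (zero to fzero)
open import Data.Fin.Properties using (toℕ-injective; toℕ<n; toℕ-fromℕ<; toℕ-inject₁)
open import Data.Fin.Subset using (Subset; _∈_; _∉_; ⁅_⁆; _∪_; _-_; _─_; _⊂_; outside)
open import Data.Fin.Subset.Properties
  using (p⊂q⇒∣p∣<∣q∣; x∈p∪q⁻; x∈p∪q⁺; x∈⁅x⁆; x∈⁅y⁆⇒x≡y; x∈p∧x∉q⇒x∈p─q; p─q⊆p)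
open import Data.Fin.Permutation using (_⟨$⟩ʳ_; inverseˡ)
open import Data.Vec.Base using (_∷_; here; there)
open import Data.Product using (_×_; _,_)
open import Data.Sum using (_⊎_; inj₁; inj₂; [_,_]′)
open import Function using (_∘_)
open import Relation.Nullary using (¬_; yes; no)
open import Relation.Binary.Bundles using (StrictTotalOrder)
open import Relation.Binary.Definitions using (tri<; tri≈; tri>)
open import Relation.Binary.PropositionalEquality
  using (_≡_; refl; sym; trans; cong; subst; ≢-sym)

private
  variable
    n : ℕ

module _ {c ℓ₁ ℓ₂ : Level} (S : StrictTotalOrder c ℓ₁ ℓ₂) where
  open StrictTotalOrder S

  sort₃ : ∀ {p q r} → ¬ p ≈ q → ¬ q ≈ r → ¬ p ≈ r →
    (p < q × q < r) ⊎ (p < r × r < q) ⊎ (q < p × p < r) ⊎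
    (q < r × r < p) ⊎ (r < p × p < q) ⊎ (r < q × q < p)
  sort₃ {p} {q} {r} p≉q q≉r p≉r with compare p q | compare q r
  ... | tri≈ _ p≈q _ | _            = ⊥-elim (p≉q p≈q)
  ... | _            | tri≈ _ q≈r _ = ⊥-elim (q≉r q≈r)
  ... | tri< p<q _ _ | tri< q<r _ _ = inj₁ (p<q , q<r)
  ... | tri> _ _ q<p | tri> _ _ r<q = inj₂ (inj₂ (inj₂ (inj₂ (inj₂ (r<q , q<p)))))
  ... | tri< p<q _ _ | tri> _ _ r<q with compare p r
  ...   | tri< p<r _ _ = inj₂ (inj₁ (p<r , r<q))
  ...   | tri≈ _ p≈r _ = ⊥-elim (p≉r p≈r)
  ...   | tri> _ _ r<p = inj₂ (inj₂ (inj₂ (inj₂ (inj₁ (r<p , p<q)))))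
  sort₃ {p} {q} {r} p≉q q≉r p≉r | tri> _ _ q<p | tri< q<r _ _ with compare p r
  ...   | tri< p<r _ _ = inj₂ (inj₂ (inj₁ (q<p , p<r)))
  ...   | tri≈ _ p≈r _ = ⊥-elim (p≉r p≈r)
  ...   | tri> _ _ r<p = inj₂ (inj₂ (inj₂ (inj₁ (q<r , r<p))))

x∈p─q⇒x∉q : ∀ {p q : Subset n} {x} → x ∈ p ─ q → x ∉ q
x∈p─q⇒x∉q {p = _ ∷ _} {outside ∷ _} here       ()
x∈p─q⇒x∉q {p = _ ∷ _} {_ ∷ _}       (there x∈) (there x∈q) = x∈p─q⇒x∉q x∈ x∈q

module _ {p : Subset n} {r i : Fin n} where

  ∈-exchange⁻ : ∀ {x} → x ∈ (p - r) ∪ ⁅ i ⁆ → (x ∈ p × x ≢ r) ⊎ x ≡ i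
  ∈-exchange⁻ x∈ with x∈p∪q⁻ (p - r) ⁅ i ⁆ x∈
  ... | inj₁ x∈p-r = inj₁ (p─q⊆p p ⁅ r ⁆ x∈p-r ,
                           λ x≡r → x∈p─q⇒x∉q x∈p-r (subst (_∈ ⁅ r ⁆) (sym x≡r) (x∈⁅x⁆ r)))
  ... | inj₂ x∈⁅i⁆ = inj₂ (x∈⁅y⁆⇒x≡y i x∈⁅i⁆)

  ∈-exchange-kept : ∀ {x} → x ∈ p → x ≢ r → x ∈ (p - r) ∪ ⁅ i ⁆
  ∈-exchange-kept x∈p x≢r = x∈p∪q⁺ (inj₁ (x∈p∧x∉q⇒x∈p─q x∈p (x≢r ∘ x∈⁅y⁆⇒x≡y r)))

  ∈-exchange-inserted : i ∈ (p - r) ∪ ⁅ i ⁆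
  ∈-exchange-inserted = x∈p∪q⁺ (inj₂ (x∈⁅x⁆ i))

  ∉-exchange : ∀ {x} → x ∉ p ⊎ x ≡ r → x ≢ i → x ∉ (p - r) ∪ ⁅ i ⁆
  ∉-exchange out x≢i x∈ with ∈-exchange⁻ x∈ | out
  ... | inj₁ (x∈p , _)  | inj₁ x∉p = x∉p x∈p
  ... | inj₁ (_ , x≢r)  | inj₂ x≡r = x≢r x≡r
  ... | inj₂ x≡i        | _        = x≢i x≡i

next∘prev : (a : Fin n) → next (prev a) ≡ a
next∘prev {suc m} fzero with suc (toℕ (prev {suc m} fzero)) ℕ.<? suc m
... | yes m+1<m+1 = ⊥-elim (ℕ.<-irrefl (cong suc (toℕ-fromℕ< (s≤s ℕ.≤-refl))) m+1<m+1)
... | no _        = refl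
next∘prev {suc m} (Fin.suc a) with suc (toℕ (inject₁ a)) ℕ.<? suc m
... | yes a+1<m+1 = toℕ-injective (trans (toℕ-fromℕ< a+1<m+1) (cong suc (toℕ-inject₁ a)))
... | no a+1≮m+1  = ⊥-elim (a+1≮m+1 (s≤s (subst (ℕ._< m) (sym (toℕ-inject₁ a)) (toℕ<n a))))

cdist-view : (w y : Fin n) →
  (toℕ w ℕ.≤ toℕ y × cdist w y ≡ toℕ y ∸ toℕ w) ⊎
  (toℕ y ℕ.< toℕ w × cdist w y ≡ (n + toℕ y) ∸ toℕ w)
cdist-view w y with toℕ w ≤ᵇ toℕ y in w≤ᵇy
... | true  = inj₁ (ℕ.≤ᵇ⇒≤ (toℕ w) (toℕ y) (subst T (sym w≤ᵇy) tt) , refl)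
... | false = inj₂ (ℕ.≰⇒> (subst T w≤ᵇy ∘ ℕ.≤⇒≤ᵇ) , refl)

cdist-self : (w : Fin n) → cdist w w ≡ 0
cdist-self w with cdist-view w w
... | inj₁ (_ , d≡) = trans d≡ (ℕ.n∸n≡0 (toℕ w))
... | inj₂ (w<w , _) = ⊥-elim (ℕ.<-irrefl refl w<w)

module _ (w : Fin n) where
  private
    w≤n+ : (v : Fin n) → toℕ w ℕ.≤ n + toℕ v
    w≤n+ v = ℕ.≤-trans (ℕ.<⇒≤ (toℕ<n w)) (ℕ.m≤m+n n (toℕ v))

    near<far : ∀ {u v : Fin n} → toℕ w ℕ.≤ toℕ u → toℕ u ∸ toℕ w ℕ.< (n + toℕ v) ∸ toℕ w
    near<far {u} {v} w≤u = ℕ.∸-monoˡ-< (ℕ.<-≤-trans (toℕ<n u) (ℕ.m≤m+n n (toℕ v))) w≤u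

  cdist-injective : {y z : Fin n} → cdist w y ≡ cdist w z → y ≡ z
  cdist-injective {y} {z} dy≡dz with cdist-view w y | cdist-view w z
  ... | inj₁ (w≤y , dy) | inj₁ (w≤z , dz) =
    toℕ-injective (ℕ.∸-cancelʳ-≡ w≤y w≤z (trans (sym dy) (trans dy≡dz dz)))
  ... | inj₂ (_ , dy)   | inj₂ (_ , dz)   = toℕ-injective (ℕ.+-cancelˡ-≡ n _ _
    (ℕ.∸-cancelʳ-≡ (w≤n+ y) (w≤n+ z) (trans (sym dy) (trans dy≡dz dz))))
  ... | inj₁ (w≤y , dy) | inj₂ (_ , dz)   =
    ⊥-elim (ℕ.<-irrefl (trans (sym dy) (trans dy≡dz dz)) (near<far w≤y))
  ... | inj₂ (_ , dy)   | inj₁ (w≤z , dz) =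
    ⊥-elim (ℕ.<-irrefl (trans (sym dz) (trans (sym dy≡dz) dy)) (near<far w≤z))

w≢y⇒w<[w]y : {w y : Fin n} → w ≢ y → w <[ w ] y
w≢y⇒w<[w]y {w = w} {y} w≢y = subst (ℕ._< cdist w y) (sym (cdist-self w))
  (ℕ.n≢0⇒n>0 (λ dy≡0 → w≢y (sym (cdist-injective w (trans dy≡0 (sym (cdist-self w)))))))

CyclicallyOrdered : (w p q r : Fin n) → Set
CyclicallyOrdered w p q r = w <[ w ] p × p <[ w ] q × q <[ w ] r

cyclicallyOrdered-cases : {w p q r : Fin n} →
  w ≢ p → w ≢ q → w ≢ r → p ≢ q → q ≢ r → p ≢ r →
  CyclicallyOrdered w p q r ⊎ CyclicallyOrdered w p r q ⊎ CyclicallyOrdered w q p r ⊎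
  CyclicallyOrdered w q r p ⊎ CyclicallyOrdered w r p q ⊎ CyclicallyOrdered w r q p
cyclicallyOrdered-cases {w = w} {p} {q} {r} w≢p w≢q w≢r p≢q q≢r p≢r
  with sort₃ ℕ.<-strictTotalOrder {cdist w p} {cdist w q} {cdist w r}
         (p≢q ∘ cdist-injective w) (q≢r ∘ cdist-injective w) (p≢r ∘ cdist-injective w)
... | inj₁ o                                   = inj₁ (w≢y⇒w<[w]y w≢p , o)
... | inj₂ (inj₁ o)                            = inj₂ (inj₁ (w≢y⇒w<[w]y w≢p , o))
... | inj₂ (inj₂ (inj₁ o))                     = inj₂ (inj₂ (inj₁ (w≢y⇒w<[w]y w≢q , o)))
... | inj₂ (inj₂ (inj₂ (inj₁ o)))              = inj₂ (inj₂ (inj₂ (inj₁ (w≢y⇒w<[w]y w≢q , o))))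
... | inj₂ (inj₂ (inj₂ (inj₂ (inj₁ o))))       = inj₂ (inj₂ (inj₂ (inj₂ (inj₁ (w≢y⇒w<[w]y w≢r , o)))))
... | inj₂ (inj₂ (inj₂ (inj₂ (inj₂ o))))       = inj₂ (inj₂ (inj₂ (inj₂ (inj₂ (w≢y⇒w<[w]y w≢r , o)))))

_∈_∖_ : Fin n → Subset n → Subset n → Set
x ∈ p ∖ q = x ∈ p × x ∉ q

module _ {k n : ℕ} (𝓘 : GrassmannlikeNecklace k n) where

  removed inserted : Fin n → Fin n
  removed a  = ρ 𝓘 ⟨$⟩ʳ a
  inserted a = ι 𝓘 ⟨$⟩ʳ a

  trip∘removed : ∀ a → trip 𝓘 (removed a) ≡ inserted a
  trip∘removed a = cong (ι 𝓘 ⟨$⟩ʳ_) (inverseˡ (ρ 𝓘))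

  step-into : ∀ a → I 𝓘 a ≡ (I 𝓘 (prev a) - removed (prev a)) ∪ ⁅ inserted (prev a) ⁆
  step-into a = trans (cong (I 𝓘) (sym (next∘prev a))) (step 𝓘 (prev a))

  -- I (a+1) ⊆ I a would be a proper inclusion of sets of the same size k.
  inserted∉I : ∀ a → removed a ≢ inserted a → inserted a ∉ I 𝓘 a
  inserted∉I a r≢i i∈I = ℕ.<-irrefl (trans (card 𝓘 (next a)) (sym (card 𝓘 a))) (p⊂q⇒∣p∣<∣q∣ I₊⊂I)
    where
    from-step : ∀ {t} → t ∈ I 𝓘 (next a) → t ∈ (I 𝓘 a - removed a) ∪ ⁅ inserted a ⁆
    from-step {t} = subst (t ∈_) (step 𝓘 a)
    I₊⊂I : I 𝓘 (next a) ⊂ I 𝓘 a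
    I₊⊂I = (λ t∈ → [ (λ (t∈I , _) → t∈I) , (λ t≡i → subst (_∈ I 𝓘 a) (sym t≡i) i∈I) ]′
                       (∈-exchange⁻ (from-step t∈)))
         , removed a , ρ∈I 𝓘 a , ∉-exchange (inj₂ refl) r≢i ∘ from-step

  module Toggle (no-fixed-points : ∀ x → trip 𝓘 x ≢ x) (a : Fin n) where

    w x y z : Fin n
    w = removed (prev a)
    x = inserted (prev a)
    y = removed a
    z = inserted a

    I₀ I₁ I₂ : Subset n
    I₀ = I 𝓘 (prev a)
    I₁ = I 𝓘 a
    I₂ = I 𝓘 (next a)

    w≢x : w ≢ x
    w≢x w≡x = no-fixed-points w (trans (trip∘removed (prev a)) (sym w≡x))

    y≢z : y ≢ z
    y≢z y≡z = no-fixed-points y (trans (trip∘removed a) (sym y≡z))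

    private
      into₁ : ∀ {t} → t ∈ (I₀ - w) ∪ ⁅ x ⁆ → t ∈ I₁
      into₁ {t} = subst (t ∈_) (sym (step-into a))
      from₁ : ∀ {t} → t ∈ I₁ → t ∈ (I₀ - w) ∪ ⁅ x ⁆
      from₁ {t} = subst (t ∈_) (step-into a)
      into₂ : ∀ {t} → t ∈ (I₁ - y) ∪ ⁅ z ⁆ → t ∈ I₂
      into₂ {t} = subst (t ∈_) (sym (step 𝓘 a))
      from₂ : ∀ {t} → t ∈ I₂ → t ∈ (I₁ - y) ∪ ⁅ z ⁆
      from₂ {t} = subst (t ∈_) (step 𝓘 a)

    w∈I₀∖I₂ : w ≢ z → w ∈ I₀ ∖ I₂
    w∈I₀∖I₂ w≢z = ρ∈I 𝓘 (prev a) , ∉-exchange (inj₁ w∉I₁) w≢z ∘ from₂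
      where
      w∉I₁ : w ∉ I₁
      w∉I₁ = ∉-exchange (inj₂ refl) w≢x ∘ from₁

    y∈I₀∖I₂ : x ≢ y → y ∈ I₀ ∖ I₂
    y∈I₀∖I₂ x≢y = y∈I₀ , ∉-exchange (inj₂ refl) y≢z ∘ from₂
      where
      y∈I₀ : y ∈ I₀
      y∈I₀ = [ (λ (y∈I₀ , _) → y∈I₀) , (λ y≡x → ⊥-elim (x≢y (sym y≡x))) ]′
               (∈-exchange⁻ (from₁ (ρ∈I 𝓘 a)))

    x∈I₂∖I₀ : x ≢ y → x ∈ I₂ ∖ I₀
    x∈I₂∖I₀ x≢y = into₂ (∈-exchange-kept (into₁ ∈-exchange-inserted) x≢y) , inserted∉I (prev a) w≢x

    z∈I₂∖I₀ : w ≢ z → z ∈ I₂ ∖ I₀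
    z∈I₂∖I₀ w≢z = into₂ ∈-exchange-inserted
                , λ z∈I₀ → inserted∉I a y≢z (into₁ (∈-exchange-kept z∈I₀ (≢-sym w≢z)))

lemma4p12 : (k n : ℕ) (𝓘 : GrassmannlikeNecklace k n) →
    WeaklySeparatedNecklace 𝓘 →
    (∀ x → trip 𝓘 x ≢ x) →
    ∀ (a : Fin n) → NoncrossingToggle 𝓘 a → AlignedToggle 𝓘 a
lemma4p12 k n 𝓘 ws no-fixed-points a
  (allowed , noncrossing@(w≢y , w≢z , x≢y , x≢z , ¬cross₁ , ¬cross₂)) =
  allowed , noncrossing , aligned
  where
  open Toggle 𝓘 no-fixed-points a
  ¬alternating : ∀ {b d} → CyclicallyOrdered w b y d → b ∈ I₂ ∖ I₀ → d ∈ I₂ ∖ I₀ → ⊥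
  ¬alternating o b∈ d∈ =
    ws (prev a) (next a) (w , _ , y , _ , o , w∈I₀∖I₂ w≢z , y∈I₀∖I₂ x≢y , b∈ , d∈)
  aligned : CyclicallyOrdered w y z x ⊎ CyclicallyOrdered w x z y ⊎ (w ≡ x × w <[ w ] y × y <[ w ] z)
  aligned with cyclicallyOrdered-cases w≢y w≢z w≢x y≢z (≢-sym x≢z) (≢-sym x≢y)
  ... | inj₁ wyzx                             = inj₁ wyzx
  ... | inj₂ (inj₁ wyxz)                      = ⊥-elim (¬cross₁ wyxz)
  ... | inj₂ (inj₂ (inj₁ wzyx))               = ⊥-elim (¬alternating wzyx (z∈I₂∖I₀ w≢z) (x∈I₂∖I₀ x≢y))
  ... | inj₂ (inj₂ (inj₂ (inj₁ wzxy)))        = ⊥-elim (¬cross₂ wzxy)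
  ... | inj₂ (inj₂ (inj₂ (inj₂ (inj₁ wxyz)))) = ⊥-elim (¬alternating wxyz (x∈I₂∖I₀ x≢y) (z∈I₂∖I₀ w≢z))
  ... | inj₂ (inj₂ (inj₂ (inj₂ (inj₂ wxzy)))) = inj₂ (inj₁ wxzy)
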